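{- For every positive integer $n$, $$M^L(n+2)\leq 4K(n),$$ where $M^L(m)$ denotes the minimum cardinality of a local identifying code in the binary $m$-dimensional hypercube and $K(n)$ denotes the minimum cardinality of a covering code in the binary $n$-dimensional hypercube.
   Context: The binary $n$-dimensional hypercube is the graph with vertex set $\{0,1\}^n$ in which two binary words are adjacent iff their Hamming distance is $1$. For a vertex $u$, $N[u]$ is its closed neighbourhood, and for a code (nonempty vertex subset) $C$, $I_C(u)=N[u]\cap C$. A code $C$ is a covering code if $I_C(u)\neq\emptyset$ for every vertex $u$. A code $C$ is a local identifying code if it is a covering code and $I_C(u)\neq I_C(v)$ for every pair of adjacent vertices $u,v$. -}

module Defs where

open import Data.Bool using (Bool; true; false; not; T; _≟_)
open import Data.Nat using (ℕ; zero; suc; _+_)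
open import Data.Vec using (Vec; []; _∷_; map; _++_)
open import Data.List using (List; []; _∷_; length; filter) renaming (map to lmap; _++_ to _+++_)
open import Data.Sum using (_⊎_)
open import Data.Product using (Σ; ∃; _×_; _,_)
open import Relation.Nullary using (¬_)
open import Relation.Binary.PropositionalEquality using (_≡_)
open import Function.Bundles using (_⇔_)

Word : ℕ → Set
Word n = Vec Bool n

hamming : ∀ {n} → Word n → Word n → ℕ
hamming [] [] = 0
hamming (true ∷ x) (true ∷ y) = hamming x y
hamming (false ∷ x) (false ∷ y) = hamming x y
hamming (true ∷ x) (false ∷ y) = suc (hamming x y)
hamming (false ∷ x) (true ∷ y) = suc (hamming x y)

Adj : ∀ {n} → Word n → Word n → Set
Adj u v = hamming u v ≡ 1

InClosedNbhd : ∀ {n} → Word n → Word n → Set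
InClosedNbhd w u = (w ≡ u) ⊎ Adj w u

-- A code is a vertex subset, given by its characteristic function.
Code : ℕ → Set
Code n = Word n → Bool

InI : ∀ {n} → Code n → Word n → Word n → Set
InI C u w = InClosedNbhd w u × T (C w)

allWords : (n : ℕ) → List (Word n)
allWords zero = [] ∷ []
allWords (suc n) = lmap (true ∷_) (allWords n) +++ lmap (false ∷_) (allWords n)

card : ∀ {n} → Code n → ℕ
card {n} C = length (filter (λ w → C w ≟ true) (allWords n))

IsCoveringCode : ∀ {n} → Code n → Set
IsCoveringCode {n} C = (u : Word n) → ∃ λ w → InI C u w

IsLocalIdentifyingCode : ∀ {n} → Code n → Set
IsLocalIdentifyingCode {n} C =
  IsCoveringCode C ×
  ((u v : Word n) → Adj u v → ¬ ((w : Word n) → InI C u w ⇔ InI C v w))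

-- Take D = C × Q₂ ⊆ Q_{n+2}, so |D| = 4|C|, and D covers because C does.
-- Adjacent vertices differ either in the Q₂ part, (x,a) ~ (x,b), or in the
-- prefix, (x,a) ~ (y,a). In the first case (x, b̄), with b̄ the antipode of b,
-- separates them when x ∈ C, and (c,a) with c ∈ C adjacent to x does
-- otherwise. In the second case (x,a') with a' ~ a separates them when x ∈ C
-- (symmetrically y ∈ C); otherwise (c,a) with c ∈ C adjacent to x does, as c
-- cannot also be adjacent to y: the hypercube is bipartite.
module Submission where

open import Defs
open import Data.Nat using (ℕ; suc; _+_; _*_; _≤_)
open import Data.Product using (Σ; _×_)

import Algebra.Properties.CommutativeSemigroup as CommutativeSemigroupProperties
open import Data.Bool using (Bool; true; false; not; T; _≟_)
open import Data.List as List using (List; []; _∷_; length; filter)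
open import Data.List.Properties using (length-++; filter-++)
open import Data.Nat using (zero; z≤n; s≤s; _^_; parity)
open import Data.Nat.Properties using
  (≤-refl; ≤-reflexive; +-suc; +-identityʳ; +-cancelʳ-≡; *-comm; *-distribʳ-+; m+n≤o⇒m≤o; suc-injective)
open import Data.Parity.Base as ℙ using (0ℙ; 1ℙ)
open import Data.Parity.Properties using (+-homo-+; +-commutativeSemigroup)
open import Data.Product using (∃; _,_)
open import Data.Sum using (_⊎_; inj₁; inj₂; swap)
open import Data.Vec using (Vec; []; _∷_; _++_; map; take; splitAt)
open import Function using (_∘_)
open import Function.Bundles using (_⇔_; Equivalence)
open import Level using (Level)
open import Relation.Nullary using (¬_; yes; no; does; contradiction)
open import Relation.Nullary.Decidable using (T?)
open import Relation.Unary using (Pred; Decidable)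
open import Relation.Binary.PropositionalEquality
  using (_≡_; refl; sym; trans; cong; cong₂; subst; module ≡-Reasoning)

open CommutativeSemigroupProperties +-commutativeSemigroup using (interchange)
open ≡-Reasoning

private variable
  ℓ ℓ′ : Level
  A B : Set ℓ
  m n k : ℕ

hamming-refl : (x : Word m) → hamming x x ≡ 0
hamming-refl []          = refl
hamming-refl (true ∷ x)  = hamming-refl x
hamming-refl (false ∷ x) = hamming-refl x

hamming-sym : (x y : Word m) → hamming x y ≡ hamming y x
hamming-sym []          []          = refl
hamming-sym (true ∷ x)  (true ∷ y)  = hamming-sym x y
hamming-sym (false ∷ x) (false ∷ y) = hamming-sym x y
hamming-sym (true ∷ x)  (false ∷ y) = cong suc (hamming-sym x y)
hamming-sym (false ∷ x) (true ∷ y)  = cong suc (hamming-sym x y)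

hamming≡0⇒≡ : (x y : Word m) → hamming x y ≡ 0 → x ≡ y
hamming≡0⇒≡ []          []          _ = refl
hamming≡0⇒≡ (true ∷ x)  (true ∷ y)  d = cong (true ∷_) (hamming≡0⇒≡ x y d)
hamming≡0⇒≡ (false ∷ x) (false ∷ y) d = cong (false ∷_) (hamming≡0⇒≡ x y d)

hamming-++ : (x y : Word m) (a b : Word k) →
             hamming (x ++ a) (y ++ b) ≡ hamming x y + hamming a b
hamming-++ []          []          a b = refl
hamming-++ (true ∷ x)  (true ∷ y)  a b = hamming-++ x y a b
hamming-++ (false ∷ x) (false ∷ y) a b = hamming-++ x y a b
hamming-++ (true ∷ x)  (false ∷ y) a b = cong suc (hamming-++ x y a b)
hamming-++ (false ∷ x) (true ∷ y)  a b = cong suc (hamming-++ x y a b)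

hamming-antipode : (x y : Word m) → hamming (map not x) y + hamming x y ≡ m
hamming-antipode []          []          = refl
hamming-antipode (true ∷ x)  (true ∷ y)  = cong suc (hamming-antipode x y)
hamming-antipode (false ∷ x) (false ∷ y) = cong suc (hamming-antipode x y)
hamming-antipode (true ∷ x)  (false ∷ y) = trans (+-suc _ _) (cong suc (hamming-antipode x y))
hamming-antipode (false ∷ x) (true ∷ y)  = trans (+-suc _ _) (cong suc (hamming-antipode x y))

hamming-antipode-self : (x : Word m) → hamming (map not x) x ≡ m
hamming-antipode-self x = begin
  hamming (map not x) x                 ≡⟨ +-identityʳ _ ⟨
  hamming (map not x) x + 0             ≡⟨ cong (hamming (map not x) x +_) (hamming-refl x) ⟨
  hamming (map not x) x + hamming x x   ≡⟨ hamming-antipode x x ⟩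
  _                                     ∎

antipode-adjacent : (a b : Word 2) → hamming a b ≡ 1 → hamming (map not b) a ≡ 1
antipode-adjacent a b a∼b = +-cancelʳ-≡ 1 _ _ (begin
  hamming (map not b) a + 1
    ≡⟨ cong (hamming (map not b) a +_) (trans (hamming-sym b a) a∼b) ⟨
  hamming (map not b) a + hamming b a
    ≡⟨ hamming-antipode b a ⟩
  2 ∎)

flipHead : Word (suc m) → Word (suc m)
flipHead (b ∷ x) = not b ∷ x

hamming-flipHead : (x : Word (suc m)) → hamming (flipHead x) x ≡ 1
hamming-flipHead (true ∷ x)  = cong suc (hamming-refl x)
hamming-flipHead (false ∷ x) = cong suc (hamming-refl x)

parity-hamming-triangle : (x y z : Word m) →
  parity (hamming x z) ≡ parity (hamming x y) ℙ.+ parity (hamming y z)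
parity-hamming-triangle []      []      []      = refl
parity-hamming-triangle (a ∷ x) (b ∷ y) (c ∷ z) = begin
  parity (hamming (a ∷ x) (c ∷ z))
    ≡⟨ cong parity (hamming-++ [ a ] [ c ] x z) ⟩
  parity (hamming [ a ] [ c ] + hamming x z)
    ≡⟨ +-homo-+ (hamming [ a ] [ c ]) (hamming x z) ⟩
  parity (hamming [ a ] [ c ]) ℙ.+ parity (hamming x z)
    ≡⟨ cong₂ ℙ._+_ (bits a b c) (parity-hamming-triangle x y z) ⟩
  (P [ a ] [ b ] ℙ.+ P [ b ] [ c ]) ℙ.+ (P x y ℙ.+ P y z)
    ≡⟨ interchange (P [ a ] [ b ]) (P [ b ] [ c ]) (P x y) (P y z) ⟩
  (P [ a ] [ b ] ℙ.+ P x y) ℙ.+ (P [ b ] [ c ] ℙ.+ P y z)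
    ≡⟨ cong₂ ℙ._+_ (split [ a ] [ b ] x y) (split [ b ] [ c ] y z) ⟨
  P (a ∷ x) (b ∷ y) ℙ.+ P (b ∷ y) (c ∷ z)
    ∎
  where
  [_] : Bool → Word 1
  [ b ] = b ∷ []

  P : Word n → Word n → ℙ.Parity
  P x y = parity (hamming x y)

  split : (x y : Word 1) (a b : Word n) → P (x ++ a) (y ++ b) ≡ P x y ℙ.+ P a b
  split x y a b = trans (cong parity (hamming-++ x y a b)) (+-homo-+ (hamming x y) (hamming a b))

  bits : ∀ a b c → P [ a ] [ c ] ≡ P [ a ] [ b ] ℙ.+ P [ b ] [ c ]
  bits true  true  true  = refl
  bits true  true  false = refl
  bits true  false true  = refl
  bits true  false false = refl
  bits false true  true  = refl
  bits false true  false = refl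
  bits false false true  = refl
  bits false false false = refl

hypercube-triangle-free : (x y z : Word m) →
  hamming x y ≡ 1 → hamming y z ≡ 1 → ¬ hamming x z ≡ 1
hypercube-triangle-free x y z x∼y y∼z x∼z = 1ℙ≢0ℙ (begin
  1ℙ                                             ≡⟨ cong parity x∼z ⟨
  parity (hamming x z)                           ≡⟨ parity-hamming-triangle x y z ⟩
  parity (hamming x y) ℙ.+ parity (hamming y z)  ≡⟨ cong₂ (λ d e → parity d ℙ.+ parity e) x∼y y∼z ⟩
  0ℙ                                             ∎)
  where
  1ℙ≢0ℙ : ¬ 1ℙ ≡ 0ℙ
  1ℙ≢0ℙ ()

inClosedNbhd⇒hamming≤1 : {w u : Word m} → InClosedNbhd w u → hamming w u ≤ 1
inClosedNbhd⇒hamming≤1 {w = w} (inj₁ refl) = subst (_≤ 1) (sym (hamming-refl w)) z≤n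
inClosedNbhd⇒hamming≤1 (inj₂ w∼u)          = ≤-reflexive w∼u

hamming≤1⇒inClosedNbhd : (w u : Word m) → hamming w u ≤ 1 → InClosedNbhd w u
hamming≤1⇒inClosedNbhd w u d≤1 with hamming w u in d≡
... | zero     = inj₁ (hamming≡0⇒≡ w u d≡)
... | suc zero = inj₂ refl
hamming≤1⇒inClosedNbhd w u (s≤s ()) | suc (suc _)

m+n≡1⇒ : ∀ m {n} → m + n ≡ 1 → (m ≡ 0 × n ≡ 1) ⊎ (m ≡ 1 × n ≡ 0)
m+n≡1⇒ zero          m+n≡1 = inj₁ (refl , m+n≡1)
m+n≡1⇒ (suc zero)    m+n≡1 = inj₂ (refl , suc-injective m+n≡1)
m+n≡1⇒ (suc (suc m)) ()

Separated : Code m → Word m → Word m → Set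
Separated D u v = (∃ λ w → InI D u w × ¬ InI D v w) ⊎ (∃ λ w → InI D v w × ¬ InI D u w)

separated⇒≢I : {D : Code m} {u v : Word m} →
  Separated D u v → ¬ ((w : Word m) → InI D u w ⇔ InI D v w)
separated⇒≢I (inj₁ (w , w∈Iu , w∉Iv)) sameI = w∉Iv (Equivalence.to (sameI w) w∈Iu)
separated⇒≢I (inj₂ (w , w∈Iv , w∉Iu)) sameI = w∉Iu (Equivalence.from (sameI w) w∈Iv)

take-++ : (xs : Vec A n) (ys : Vec A k) → take n (xs ++ ys) ≡ xs
take-++ []       ys = refl
take-++ (x ∷ xs) ys = cong (x ∷_) (take-++ xs ys)

_×Q_ : Code n → (k : ℕ) → Code (n + k)
_×Q_ {n} C k w = C (take n w)

module _ (C : Code n) where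

  ∈I-×Q : {x y : Word n} {a b : Word k} →
    hamming x y + hamming a b ≤ 1 → T (C x) → InI (C ×Q k) (y ++ b) (x ++ a)
  ∈I-×Q {x = x} {y} {a} {b} d≤1 x∈C =
      hamming≤1⇒inClosedNbhd _ _ (subst (_≤ 1) (sym (hamming-++ x y a b)) d≤1)
    , subst (T ∘ C) (sym (take-++ x a)) x∈C

  ∈I-×Q⇒hamming≤1 : {x y : Word n} {a b : Word k} →
    InI (C ×Q k) (y ++ b) (x ++ a) → hamming x y + hamming a b ≤ 1
  ∈I-×Q⇒hamming≤1 {x = x} {y} {a} {b} (w∈N[u] , _) =
    subst (_≤ 1) (hamming-++ x y a b) (inClosedNbhd⇒hamming≤1 w∈N[u])

  ×Q-isCovering : IsCoveringCode C → IsCoveringCode (C ×Q k)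
  ×Q-isCovering cov u with splitAt n u
  ... | x , a , refl with cov x
  ... | c , c∈N[x] , c∈C = c ++ a , ∈I-×Q near c∈C
    where
    near : hamming c x + hamming a a ≤ 1
    near rewrite hamming-refl a | +-identityʳ (hamming c x) = inClosedNbhd⇒hamming≤1 c∈N[x]

module _ (C : Code n) (cov : IsCoveringCode C) where

  private
    D : Code (n + 2)
    D = C ×Q 2

  adjacentCodeword : (x : Word n) → ¬ T (C x) → ∃ λ c → T (C c) × hamming c x ≡ 1
  adjacentCodeword x x∉C with cov x
  ... | c , inj₁ refl , c∈C = contradiction c∈C x∉C
  ... | c , inj₂ c∼x  , c∈C = c , c∈C , c∼x

  separatedBy : {x y : Word n} {a b : Word 2} (x′ : Word n) (a′ : Word 2) → T (C x′) →
    hamming x′ x + hamming a′ a ≤ 1 → ¬ hamming x′ y + hamming a′ b ≤ 1 →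
    Separated D (x ++ a) (y ++ b)
  separatedBy {y = y} {b = b} x′ a′ x′∈C near far =
    inj₁ (x′ ++ a′ , ∈I-×Q C near x′∈C , far ∘ ∈I-×Q⇒hamming≤1 C {x = x′} {y} {a′} {b})

  separated-suffix : (x : Word n) {a b : Word 2} → hamming a b ≡ 1 →
    Separated D (x ++ a) (x ++ b)
  separated-suffix x {a} {b} a∼b with T? (C x)
  ... | yes x∈C = separatedBy x (map not b) x∈C near far
    where
    near : hamming x x + hamming (map not b) a ≤ 1
    near rewrite hamming-refl x | antipode-adjacent a b a∼b = ≤-refl
    far : ¬ hamming x x + hamming (map not b) b ≤ 1
    far rewrite hamming-refl x | hamming-antipode-self b = λ { (s≤s ()) }
  ... | no x∉C with adjacentCodeword x x∉C
  ... | c , c∈C , c∼x = separatedBy c a c∈C near far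
    where
    near : hamming c x + hamming a a ≤ 1
    near rewrite c∼x | hamming-refl a = ≤-refl
    far : ¬ hamming c x + hamming a b ≤ 1
    far rewrite c∼x | a∼b = λ { (s≤s ()) }

  separated-prefix-∈C : {x y : Word n} (a : Word 2) → T (C x) → hamming x y ≡ 1 →
    Separated D (x ++ a) (y ++ a)
  separated-prefix-∈C {x} {y} a x∈C x∼y = separatedBy x (flipHead a) x∈C near far
    where
    near : hamming x x + hamming (flipHead a) a ≤ 1
    near rewrite hamming-refl x | hamming-flipHead a = ≤-refl
    far : ¬ hamming x y + hamming (flipHead a) a ≤ 1
    far rewrite x∼y | hamming-flipHead a = λ { (s≤s ()) }

  separated-prefix : {x y : Word n} (a : Word 2) → hamming x y ≡ 1 →
    Separated D (x ++ a) (y ++ a)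
  separated-prefix {x} {y} a x∼y with T? (C x) | T? (C y)
  ... | yes x∈C | _       = separated-prefix-∈C a x∈C x∼y
  ... | no _    | yes y∈C = swap (separated-prefix-∈C a y∈C (trans (hamming-sym y x) x∼y))
  ... | no x∉C  | no y∉C  with adjacentCodeword x x∉C
  ... | c , c∈C , c∼x = separatedBy c a c∈C near far
    where
    near : hamming c x + hamming a a ≤ 1
    near rewrite c∼x | hamming-refl a = ≤-refl
    far : ¬ hamming c y + hamming a a ≤ 1
    far d≤1 with hamming≤1⇒inClosedNbhd c y (m+n≤o⇒m≤o (hamming c y) d≤1)
    ... | inj₁ refl = y∉C c∈C
    ... | inj₂ c∼y  = hypercube-triangle-free c x y c∼x x∼y c∼y

  separated-++ : (x y : Word n) (a b : Word 2) → hamming x y + hamming a b ≡ 1 →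
    Separated D (x ++ a) (y ++ b)
  separated-++ x y a b d≡1 with m+n≡1⇒ (hamming x y) d≡1
  ... | inj₁ (x≈y , a∼b) rewrite hamming≡0⇒≡ x y x≈y = separated-suffix y a∼b
  ... | inj₂ (x∼y , a≈b) rewrite hamming≡0⇒≡ a b a≈b = separated-prefix b x∼y

  separated-adjacent : (u v : Word (n + 2)) → Adj u v → Separated D u v
  separated-adjacent u v u∼v with splitAt n u | splitAt n v
  ... | x , a , refl | y , b , refl =
    separated-++ x y a b (trans (sym (hamming-++ x y a b)) u∼v)

  ×Q2-isLocalIdentifying : IsLocalIdentifyingCode D
  ×Q2-isLocalIdentifying =
    ×Q-isCovering C cov , λ u v u∼v → separated⇒≢I (separated-adjacent u v u∼v)

length-filter-map : {P : Pred A ℓ′} (P? : Decidable P) (f : B → A) (xs : List B) →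
  length (filter P? (List.map f xs)) ≡ length (filter (P? ∘ f) xs)
length-filter-map P? f []       = refl
length-filter-map P? f (x ∷ xs) with does (P? (f x))
... | true  = cong suc (length-filter-map P? f xs)
... | false = length-filter-map P? f xs

card-∷ : (C : Code (suc n)) →
  card C ≡ card (λ w → C (true ∷ w)) + card (λ w → C (false ∷ w))
card-∷ {n} C = begin
  length (filter P? (List.map (true ∷_) ws List.++ List.map (false ∷_) ws))
    ≡⟨ cong length (filter-++ P? (List.map (true ∷_) ws) _) ⟩
  length (filter P? (List.map (true ∷_) ws) List.++ filter P? (List.map (false ∷_) ws))
    ≡⟨ length-++ (filter P? (List.map (true ∷_) ws)) ⟩
  length (filter P? (List.map (true ∷_) ws)) + length (filter P? (List.map (false ∷_) ws))
    ≡⟨ cong₂ _+_ (length-filter-map P? (true ∷_) ws) (length-filter-map P? (false ∷_) ws) ⟩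
  card (λ w → C (true ∷ w)) + card (λ w → C (false ∷ w))
    ∎
  where
  ws = allWords n
  P? = λ w → C w ≟ true

card-full : card {k} (λ _ → true) ≡ 2 ^ k
card-full {zero}  = refl
card-full {suc k} = begin
  card {suc k} (λ _ → true)                      ≡⟨ card-∷ {k} (λ _ → true) ⟩
  card {k} (λ _ → true) + card {k} (λ _ → true)  ≡⟨ cong₂ _+_ (card-full {k}) (card-full {k}) ⟩
  2 ^ k + 2 ^ k                                  ≡⟨ cong (2 ^ k +_) (+-identityʳ (2 ^ k)) ⟨
  2 ^ suc k                                      ∎

card-empty : card {k} (λ _ → false) ≡ 0
card-empty {zero}  = refl
card-empty {suc k} =
  trans (card-∷ {k} (λ _ → false)) (cong₂ _+_ (card-empty {k}) (card-empty {k}))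

card-×Q : (C : Code n) → card (C ×Q k) ≡ card C * 2 ^ k
card-×Q {zero} {k} C with C []
... | true  = trans (card-full {k}) (sym (+-identityʳ (2 ^ k)))
... | false = card-empty {k}
card-×Q {suc n} {k} C = begin
  card (C ×Q k)                                  ≡⟨ card-∷ (C ×Q k) ⟩
  card (Ct ×Q k) + card (Cf ×Q k)                ≡⟨ cong₂ _+_ (card-×Q Ct) (card-×Q Cf) ⟩
  card Ct * 2 ^ k + card Cf * 2 ^ k              ≡⟨ *-distribʳ-+ (2 ^ k) (card Ct) (card Cf) ⟨
  (card Ct + card Cf) * 2 ^ k                    ≡⟨ cong (_* 2 ^ k) (card-∷ C) ⟨
  card C * 2 ^ k                                 ∎
  where
  Ct Cf : Code n
  Ct w = C (true ∷ w)
  Cf w = C (false ∷ w)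

-- The construction does not need the hypothesis 1 ≤ n.
mainTheorem9 : (n : ℕ) → 1 ≤ n →
    (C : Code n) → IsCoveringCode C →
    Σ (Code (n + 2)) (λ D → IsLocalIdentifyingCode D × (card D ≤ 4 * card C))
mainTheorem9 n _ C cov =
  C ×Q 2 , ×Q2-isLocalIdentifying C cov , ≤-reflexive (trans (card-×Q C) (*-comm (card C) 4))
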